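{- Let $T$ be a standard skew tableau of shape $\alpha/\beta$, and let $\beta/\gamma$ be a skew shape with no two boxes in the same row. Let $\tilde T$ be obtained by performing jeu-de-taquin slides on $T$ into the boxes of $\beta/\gamma$, starting with the bottom box and proceeding upward. Suppose $a>b$ are labels of $T$ such that $a$ appears strictly to the left of $b$, and $b$ appears in row $j$ of $T$. Then $a$ appears in a row strictly lower than $j$ in $\tilde T$.
   Context: Young diagrams are in English notation with rows numbered from top to bottom ("lower" means larger row index). A jeu-de-taquin slide into an inner box moves into the empty box the smaller of the entries immediately to its right and immediately below it, repeating until the empty box leaves the shape. -}

module Defs where

open import Data.Nat using (ℕ; zero; suc; _+_; _∸_; _≤_; _<_; _<ᵇ_; _≡ᵇ_)
open import Data.Bool using (Bool; true; false; if_then_else_; _∧_)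
open import Data.List using (List; []; _∷_; length)
open import Data.Nat.ListAction using (sum)
open import Data.Maybe using (Maybe; just; nothing)
open import Data.Product using (_×_; ∃; ∃-syntax; _,_)
open import Relation.Binary.PropositionalEquality using (_≡_)

-- Row lengths of a partition, given as a list, rows indexed from 0 (top);
-- rows past the end of the list have length 0.
row : List ℕ → ℕ → ℕ
row []       _       = 0
row (x ∷ _)  zero    = x
row (_ ∷ xs) (suc i) = row xs i

IsPartition : List ℕ → Set
IsPartition λ' = ∀ i → row λ' (suc i) ≤ row λ' i

_⊆_ : List ℕ → List ℕ → Set
β ⊆ α = ∀ i → row β i ≤ row α i

size : List ℕ → ℕ
size = sum

InSkew : List ℕ → List ℕ → ℕ → ℕ → Set
InSkew α β r c = (row β r ≤ c) × (c < row α r)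

-- A (partial) filling of the plane: entry at (row, column), or empty.
Tab : Set
Tab = ℕ → ℕ → Maybe ℕ

record IsStandardSkew (α β : List ℕ) (T : Tab) : Set where
  field
    filled   : ∀ r c → InSkew α β r c → ∃[ x ] T r c ≡ just x
    empty    : ∀ r c x → T r c ≡ just x → InSkew α β r c
    labels   : ∀ r c x → T r c ≡ just x → (1 ≤ x) × (x ≤ size α ∸ size β)
    allUsed  : ∀ x → 1 ≤ x → x ≤ size α ∸ size β → ∃[ r ] ∃[ c ] T r c ≡ just x
    injective : ∀ r c r' c' x → T r c ≡ just x → T r' c' ≡ just x → (r ≡ r') × (c ≡ c')
    rowInc   : ∀ r c x y → T r c ≡ just x → T r (suc c) ≡ just y → x < y
    colInc   : ∀ r c x y → T r c ≡ just x → T (suc r) c ≡ just y → x < y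

set : Tab → ℕ → ℕ → Maybe ℕ → Tab
set T r c v r' c' = if (r ≡ᵇ r') ∧ (c ≡ᵇ c') then v else T r' c'

move : Tab → ℕ → ℕ → ℕ → ℕ → Tab
move T fr fc tr tc = set (set T tr tc (T fr fc)) fr fc nothing

-- The first argument
-- is fuel; every step moves the hole into a new box, so fuel
-- suc (size α) is always sufficient for tableaux inside α.
slide : ℕ → Tab → ℕ → ℕ → Tab
slide zero    T r c = T
slide (suc k) T r c with T r (suc c) | T (suc r) c
... | nothing | nothing = set T r c nothing
... | just x  | nothing = slide k (move T r (suc c) r c) r (suc c)
... | nothing | just y  = slide k (move T (suc r) c r c) (suc r) c
... | just x  | just y  =
  if x <ᵇ y then slide k (move T r (suc c) r c) r (suc c)
            else slide k (move T (suc r) c r c) (suc r) c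

-- Slide (if there is a box of β/γ in row i, namely (i , β_i - 1)) into it.
slideRow : (α β γ : List ℕ) → ℕ → Tab → Tab
slideRow α β γ i T =
  if row γ i <ᵇ row β i then slide (suc (size α)) T i (row β i ∸ 1) else T

-- Process rows n-1, n-2, …, 0 in this order (bottom box first, then upward).
slidesUp : (α β γ : List ℕ) → ℕ → Tab → Tab
slidesUp α β γ zero    T = T
slidesUp α β γ (suc i) T = slidesUp α β γ i (slideRow α β γ i T)

slideInto : (α β γ : List ℕ) → Tab → Tab
slideInto α β γ T = slidesUp α β γ (length β) T

-- Since T increases along rows and columns and a > b, the label a lies strictly below row j.
-- During the slides a only moves up or left, and it enters row j only if the hole sits in row j
-- directly above it while the entry to the right of the hole is not smaller than a.  An entry
-- smaller than a in row j to the right of a prevents this; such an entry can only disappear when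
-- the hole of a slide travels through row j to the right of a.  The path of that slide then acts as
-- a barrier: directly above it, the entry to the right of a hole is smaller than the one below, so
-- the holes of the later slides, which start in higher rows because the boxes of β/γ lie in
-- distinct rows and are treated bottom-up, never step down across it and stay away from a.

module Submission where

open import Defs
open import Data.Nat using (ℕ; zero; suc; _+_; _∸_; _≤_; _<_; _>_; _<ᵇ_; _≡ᵇ_; z≤n; s≤s; s≤s⁻¹)
open import Data.Nat.Properties
open import Data.Bool using (true; false; T; if_then_else_)
open import Data.List using (List; []; _∷_; length)
open import Data.Maybe using (just; nothing)
open import Data.Maybe.Properties using (just-injective)
open import Data.Product using (_×_; ∃-syntax; _,_; proj₁; proj₂)
open import Data.Sum using (_⊎_; inj₁; inj₂; map₂)
open import Data.Empty using (⊥; ⊥-elim)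
open import Relation.Nullary using (¬_; yes; no; _×-dec_; contradiction)
open import Relation.Binary.PropositionalEquality
open import Function using (_∘_; case_of_)

nothing≢just : ∀ {A : Set} {x : A} → nothing ≢ just x
nothing≢just ()

≡ᵇ-refl : ∀ n → (n ≡ᵇ n) ≡ true
≡ᵇ-refl zero    = refl
≡ᵇ-refl (suc n) = ≡ᵇ-refl n

≢⇒≡ᵇ≡false : ∀ {m n} → ¬ (m ≡ n) → (m ≡ᵇ n) ≡ false
≢⇒≡ᵇ≡false {m} {n} m≢n with m ≡ᵇ n in eq
... | true  = ⊥-elim (m≢n (≡ᵇ⇒≡ m n (subst T (sym eq) _)))
... | false = refl

<ᵇ≡true⇒< : ∀ {m n} → (m <ᵇ n) ≡ true → m < n
<ᵇ≡true⇒< {m} {n} eq = <ᵇ⇒< m n (subst T (sym eq) _)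

<ᵇ≡false⇒≮ : ∀ {m n} → (m <ᵇ n) ≡ false → ¬ (m < n)
<ᵇ≡false⇒≮ eq m<n = subst T eq (<⇒<ᵇ m<n)

set-≡ : ∀ S r c v → set S r c v r c ≡ v
set-≡ S r c v rewrite ≡ᵇ-refl r | ≡ᵇ-refl c = refl

set-≢ : ∀ S r c v r' c' → ¬ (r' ≡ r × c' ≡ c) → set S r c v r' c' ≡ S r' c'
set-≢ S r c v r' c' ne with r' ≟ r
... | no r'≢r rewrite ≢⇒≡ᵇ≡false (r'≢r ∘ sym) = refl
... | yes refl rewrite ≡ᵇ-refl r | ≢⇒≡ᵇ≡false {c} {c'} (λ c≡c' → ne (refl , sym c≡c')) = refl

set-empty-cell : ∀ (S : Tab) r c → S r c ≡ nothing → ∀ r' c' → set S r c nothing r' c' ≡ S r' c'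
set-empty-cell S r c empty r' c' with (r' ≟ r) ×-dec (c' ≟ c)
... | yes (refl , refl) = trans (set-≡ S r c nothing) (sym empty)
... | no  ne            = set-≢ S r c nothing r' c' ne

overwrite : (ℕ → ℕ) → ℕ → ℕ → ℕ → ℕ
overwrite f k v t = if t ≡ᵇ k then v else f t

overwrite-≡ : ∀ f k v → overwrite f k v k ≡ v
overwrite-≡ f k v rewrite ≡ᵇ-refl k = refl

overwrite-≢ : ∀ f k v t → ¬ (t ≡ k) → overwrite f k v t ≡ f t
overwrite-≢ f k v t t≢k rewrite ≢⇒≡ᵇ≡false t≢k = refl

data MoveView (S : Tab) (fr fc tr tc r c : ℕ) : Set where
  at-source : r ≡ fr → c ≡ fc → move S fr fc tr tc r c ≡ nothing → MoveView S fr fc tr tc r c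
  at-target : ¬ (r ≡ fr × c ≡ fc) → r ≡ tr → c ≡ tc → move S fr fc tr tc r c ≡ S fr fc
            → MoveView S fr fc tr tc r c
  elsewhere : ¬ (r ≡ fr × c ≡ fc) → ¬ (r ≡ tr × c ≡ tc) → move S fr fc tr tc r c ≡ S r c
            → MoveView S fr fc tr tc r c

moveView : ∀ S fr fc tr tc r c → MoveView S fr fc tr tc r c
moveView S fr fc tr tc r c with (r ≟ fr) ×-dec (c ≟ fc)
... | yes (refl , refl) = at-source refl refl (set-≡ (set S tr tc (S fr fc)) fr fc nothing)
... | no ¬src with (r ≟ tr) ×-dec (c ≟ tc)
...   | yes (refl , refl) =
        at-target ¬src refl refl (trans (set-≢ (set S r c (S fr fc)) fr fc nothing r c ¬src) (set-≡ S r c (S fr fc)))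
...   | no ¬tgt =
        elsewhere ¬src ¬tgt (trans (set-≢ (set S tr tc (S fr fc)) fr fc nothing r c ¬src) (set-≢ S tr tc (S fr fc) r c ¬tgt))

move-elsewhere : ∀ S fr fc tr tc r c → ¬ (r ≡ fr × c ≡ fc) → ¬ (r ≡ tr × c ≡ tc)
               → move S fr fc tr tc r c ≡ S r c
move-elsewhere S fr fc tr tc r c ¬src ¬tgt with moveView S fr fc tr tc r c
... | at-source p q _   = ⊥-elim (¬src (p , q))
... | at-target _ p q _ = ⊥-elim (¬tgt (p , q))
... | elsewhere _ _ e   = e

move-target : ∀ S fr fc tr tc → ¬ (tr ≡ fr × tc ≡ fc) → move S fr fc tr tc tr tc ≡ S fr fc
move-target S fr fc tr tc ¬src =
  trans (set-≢ (set S tr tc (S fr fc)) fr fc nothing tr tc ¬src) (set-≡ S tr tc (S fr fc))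

move-tracks-entry : ∀ S fr fc tr tc r c v → S tr tc ≡ nothing → ¬ (tr ≡ fr × tc ≡ fc) → S r c ≡ just v
  → (r ≡ fr × c ≡ fc × move S fr fc tr tc tr tc ≡ just v)
  ⊎ (¬ (r ≡ fr × c ≡ fc) × move S fr fc tr tc r c ≡ just v)
move-tracks-entry S fr fc tr tc r c v empty ¬src ev with moveView S fr fc tr tc r c
... | at-source refl refl _ = inj₁ (refl , refl , trans (move-target S fr fc tr tc ¬src) ev)
... | at-target _ refl refl _ = ⊥-elim (nothing≢just (trans (sym empty) ev))
... | elsewhere ¬src' _ e = inj₂ (¬src' , trans e ev)

-- Fillings of skew shapes

InShape : (ℕ → ℕ) → (ℕ → ℕ) → ℕ → ℕ → Set
InShape outer inner r c = (inner r ≤ c) × (c < outer r)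

IsDecreasing : (ℕ → ℕ) → Set
IsDecreasing f = ∀ r → f (suc r) ≤ f r

decreasing⇒antitone : ∀ {f} → IsDecreasing f → ∀ {r r'} → r ≤ r' → f r' ≤ f r
decreasing⇒antitone dec {_} {zero}   z≤n = ≤-refl
decreasing⇒antitone dec {r}  {suc r'} r≤1+r' with m≤n⇒m<n∨m≡n r≤1+r'
... | inj₁ r<1+r' = ≤-trans (dec r') (decreasing⇒antitone dec (s≤s⁻¹ r<1+r'))
... | inj₂ refl   = ≤-refl

IsOrdered : Tab → Set
IsOrdered S = ∀ r c r' c' u v → S r c ≡ just u → S r' c' ≡ just v
            → r ≤ r' → c ≤ c' → r + c < r' + c' → u < v

IsInjective : Tab → Set
IsInjective S = ∀ r c r' c' v → S r c ≡ just v → S r' c' ≡ just v → (r ≡ r') × (c ≡ c')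

+-mono-≤-≢⇒< : ∀ {a b c d} → a ≤ c → b ≤ d → ¬ (a ≡ c × b ≡ d) → a + b < c + d
+-mono-≤-≢⇒< {a} a≤c b≤d ne with m≤n⇒m<n∨m≡n a≤c | m≤n⇒m<n∨m≡n b≤d
... | inj₁ a<c  | _         = +-mono-<-≤ a<c b≤d
... | inj₂ refl | inj₁ b<d  = +-monoʳ-< a b<d
... | inj₂ refl | inj₂ refl = ⊥-elim (ne (refl , refl))

ordered⇒≤ : ∀ {S} → IsOrdered S → ∀ r c r' c' u v → S r c ≡ just u → S r' c' ≡ just v
          → r ≤ r' → c ≤ c' → u ≤ v
ordered⇒≤ ord r c r' c' u v eu ev r≤r' c≤c' with (r ≟ r') ×-dec (c ≟ c')
... | yes (refl , refl) = ≤-reflexive (just-injective (trans (sym eu) ev))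
... | no  ne            = <⇒≤ (ord r c r' c' u v eu ev r≤r' c≤c' (+-mono-≤-≢⇒< r≤r' c≤c' ne))

row+col<size : ∀ (xs : List ℕ) → IsPartition xs → ∀ r c → c < row xs r → r + c < size xs
row+col<size (x ∷ xs) hxs zero    c c<x = ≤-trans c<x (m≤m+n x _)
row+col<size (x ∷ xs) hxs (suc r) c lt  =
  +-mono-≤ (≤-trans (≤-<-trans z≤n lt) (decreasing⇒antitone hxs (z≤n {suc r})))
           (row+col<size xs (hxs ∘ suc) r c lt)

row-beyond-length : ∀ (xs : List ℕ) r → length xs ≤ r → row xs r ≡ 0
row-beyond-length []       r       _ = refl
row-beyond-length (x ∷ xs) (suc r) (s≤s len≤r) = row-beyond-length xs r len≤r

-- `bound` is a fixed shape containing `outer`; it only serves to bound the length of a slide.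
record IsFilling (bound : ℕ → ℕ) (S : Tab) (outer inner : ℕ → ℕ) : Set where
  field
    outer-decreasing : IsDecreasing outer
    inner-decreasing : IsDecreasing inner
    inner≤outer      : ∀ r → inner r ≤ outer r
    outer≤bound      : ∀ r → outer r ≤ bound r
    filled           : ∀ r c → InShape outer inner r c → ∃[ v ] S r c ≡ just v
    support          : ∀ r c v → S r c ≡ just v → InShape outer inner r c
    ordered          : IsOrdered S
    injective        : IsInjective S

record IsHoleFilling (bound : ℕ → ℕ) (S : Tab) (outer inner : ℕ → ℕ) (hr hc : ℕ) : Set where
  field
    outer-decreasing : IsDecreasing outer
    inner-decreasing : IsDecreasing inner
    inner≤outer      : ∀ r → inner r ≤ outer r
    outer≤bound      : ∀ r → outer r ≤ bound r
    hole-inside      : InShape outer inner hr hc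
    filled           : ∀ r c → InShape outer inner r c → ¬ (r ≡ hr × c ≡ hc) → ∃[ v ] S r c ≡ just v
    support          : ∀ r c v → S r c ≡ just v → InShape outer inner r c × ¬ (r ≡ hr × c ≡ hc)
    ordered          : IsOrdered S
    injective        : IsInjective S

  hole-empty : S hr hc ≡ nothing
  hole-empty with S hr hc in eq
  ... | nothing = refl
  ... | just v  = ⊥-elim (proj₂ (support hr hc v eq) (refl , refl))

module _ {bound : ℕ → ℕ} {S : Tab} {outer inner : ℕ → ℕ} {tr tc fr fc x : ℕ}
  (H : IsHoleFilling bound S outer inner tr tc) (ex : S fr fc ≡ just x)
  (tr≤fr : tr ≤ fr) (tc≤fc : tc ≤ fc) (¬tgt : ¬ (fr ≡ tr × fc ≡ tc))
  (x-minimal : ∀ r c v → S r c ≡ just v → tr ≤ r → tc ≤ c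
             → ¬ (r ≡ tr × c ≡ tc) → ¬ (r ≡ fr × c ≡ fc) → x < v) where
  open IsHoleFilling H

  move-into-hole : IsHoleFilling bound (move S fr fc tr tc) outer inner fr fc
  move-into-hole = record
    { outer-decreasing = outer-decreasing
    ; inner-decreasing = inner-decreasing
    ; inner≤outer      = inner≤outer
    ; outer≤bound      = outer≤bound
    ; hole-inside      = proj₁ (support fr fc x ex)
    ; filled           = filled′
    ; support          = support′
    ; ordered          = ordered′
    ; injective        = injective′
    }
    where
    S′ = move S fr fc tr tc

    filled′ : ∀ r c → InShape outer inner r c → ¬ (r ≡ fr × c ≡ fc) → ∃[ v ] S′ r c ≡ just v
    filled′ r c ins ¬src with moveView S fr fc tr tc r c
    ... | at-source p q _    = ⊥-elim (¬src (p , q))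
    ... | at-target _ _ _ e  = x , trans e ex
    ... | elsewhere _ ¬tgt′ e = let (v , ev) = filled r c ins ¬tgt′ in v , trans e ev

    support′ : ∀ r c v → S′ r c ≡ just v → InShape outer inner r c × ¬ (r ≡ fr × c ≡ fc)
    support′ r c v e with moveView S fr fc tr tc r c
    ... | at-source _ _ e′         = ⊥-elim (nothing≢just (trans (sym e′) e))
    ... | at-target ¬src refl refl _ = hole-inside , ¬src
    ... | elsewhere ¬src _ e′      = proj₁ (support r c v (trans (sym e′) e)) , ¬src

    ordered′ : IsOrdered S′
    ordered′ r c r' c' u v eu ev r≤r' c≤c' lt with moveView S fr fc tr tc r c | moveView S fr fc tr tc r' c'
    ... | at-source _ _ e | _ = ⊥-elim (nothing≢just (trans (sym e) eu))
    ... | _ | at-source _ _ e = ⊥-elim (nothing≢just (trans (sym e) ev))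
    ... | at-target _ refl refl _ | at-target _ refl refl _ = ⊥-elim (<-irrefl refl lt)
    ... | at-target _ refl refl e | elsewhere ¬src ¬tgt′ e′ =
          subst (_< v) (just-injective (trans (sym ex) (trans (sym e) eu)))
                (x-minimal r' c' v (trans (sym e′) ev) r≤r' c≤c' ¬tgt′ ¬src)
    ... | elsewhere _ _ e | at-target _ refl refl e′ =
          subst (u <_) (just-injective (trans (sym ex) (trans (sym e′) ev)))
                (ordered r c fr fc u x (trans (sym e) eu) ex (≤-trans r≤r' tr≤fr) (≤-trans c≤c' tc≤fc)
                         (<-≤-trans lt (+-mono-≤ tr≤fr tc≤fc)))
    ... | elsewhere _ _ e | elsewhere _ _ e′ = ordered r c r' c' u v (trans (sym e) eu) (trans (sym e′) ev) r≤r' c≤c' lt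

    injective′ : IsInjective S′
    injective′ r c r' c' v eu ev with moveView S fr fc tr tc r c | moveView S fr fc tr tc r' c'
    ... | at-source _ _ e | _ = ⊥-elim (nothing≢just (trans (sym e) eu))
    ... | _ | at-source _ _ e = ⊥-elim (nothing≢just (trans (sym e) ev))
    ... | at-target _ refl refl _ | at-target _ refl refl _ = refl , refl
    ... | at-target _ refl refl e | elsewhere ¬src _ e′ =
          let (p , q) = injective fr fc r' c' v (trans (sym e) eu) (trans (sym e′) ev) in ⊥-elim (¬src (sym p , sym q))
    ... | elsewhere ¬src _ e | at-target _ refl refl e′ =
          let (p , q) = injective r c fr fc v (trans (sym e) eu) (trans (sym e′) ev) in ⊥-elim (¬src (p , q))
    ... | elsewhere _ _ e | elsewhere _ _ e′ = injective r c r' c' v (trans (sym e) eu) (trans (sym e′) ev)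

IsFilling-inner-cong : ∀ {bound S outer inner inner′} → (∀ r → inner r ≡ inner′ r)
                     → IsFilling bound S outer inner → IsFilling bound S outer inner′
IsFilling-inner-cong inner≡ F = record
  { outer-decreasing = outer-decreasing
  ; inner-decreasing = λ r → subst₂ _≤_ (inner≡ (suc r)) (inner≡ r) (inner-decreasing r)
  ; inner≤outer      = λ r → subst (_≤ _) (inner≡ r) (inner≤outer r)
  ; outer≤bound      = outer≤bound
  ; filled           = λ r c (inner′≤c , c<outer) → filled r c (subst (_≤ c) (sym (inner≡ r)) inner′≤c , c<outer)
  ; support          = λ r c v ev → let (inner≤c , c<outer) = support r c v ev in subst (_≤ c) (inner≡ r) inner≤c , c<outer
  ; ordered          = ordered
  ; injective        = injective
  }
  where open IsFilling F

module _ {bound : ℕ → ℕ} {S : Tab} {outer inner₀ inner₁ : ℕ → ℕ} {i h : ℕ}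
  (F : IsFilling bound S outer inner₁) (inner₀-decreasing : IsDecreasing inner₀)
  (elsewhere-same : ∀ r → ¬ (r ≡ i) → inner₀ r ≡ inner₁ r)
  (inner₀-at : inner₀ i ≡ h) (inner₁-at : inner₁ i ≡ suc h) where
  open IsFilling F

  private
    inner₀≤inner₁ : ∀ r → inner₀ r ≤ inner₁ r
    inner₀≤inner₁ r with r ≟ i
    ... | yes refl = subst₂ _≤_ (sym inner₀-at) (sym inner₁-at) (n≤1+n h)
    ... | no  r≢i  = ≤-reflexive (elsewhere-same r r≢i)

  open-hole : IsHoleFilling bound S outer inner₀ i h
  open-hole = record
    { outer-decreasing = outer-decreasing
    ; inner-decreasing = inner₀-decreasing
    ; inner≤outer      = λ r → ≤-trans (inner₀≤inner₁ r) (inner≤outer r)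
    ; outer≤bound      = outer≤bound
    ; hole-inside      = ≤-reflexive inner₀-at , subst (_≤ outer i) inner₁-at (inner≤outer i)
    ; filled           = filled′
    ; support          = support′
    ; ordered          = ordered
    ; injective        = injective
    }
    where
    filled′ : ∀ r c → InShape outer inner₀ r c → ¬ (r ≡ i × c ≡ h) → ∃[ v ] S r c ≡ just v
    filled′ r c (inner₀≤c , c<outer) ¬hole with r ≟ i
    ... | yes refl = filled r c (subst (_≤ c) (sym inner₁-at)
                                   (≤∧≢⇒< (subst (_≤ c) inner₀-at inner₀≤c) (λ h≡c → ¬hole (refl , sym h≡c))) , c<outer)
    ... | no  r≢i  = filled r c (subst (_≤ c) (elsewhere-same r r≢i) inner₀≤c , c<outer)

    support′ : ∀ r c v → S r c ≡ just v → InShape outer inner₀ r c × ¬ (r ≡ i × c ≡ h)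
    support′ r c v ev =
      let (inner₁≤c , c<outer) = support r c v ev
          not-hole : ¬ (r ≡ i × c ≡ h)
          not-hole = λ { (refl , refl) → 1+n≰n (subst (_≤ c) inner₁-at inner₁≤c) }
      in (≤-trans (inner₀≤inner₁ r) inner₁≤c , c<outer) , not-hole

module _ {bound : ℕ → ℕ} {S : Tab} {outer inner : ℕ → ℕ} {hr hc : ℕ}
  (H : IsHoleFilling bound S outer inner hr hc) (right-empty : S hr (suc hc) ≡ nothing) where
  open IsHoleFilling H

  row-empty-from-hole : ∀ c → hc ≤ c → S hr c ≡ nothing
  row-empty-from-hole c hc≤c with m≤n⇒m<n∨m≡n hc≤c | S hr c in ev
  ... | _          | nothing = refl
  ... | inj₂ refl  | just v  = ⊥-elim (nothing≢just (trans (sym hole-empty) ev))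
  ... | inj₁ hc<c  | just v  =
        let right-inside = ≤-trans (proj₁ hole-inside) (n≤1+n hc) , ≤-<-trans hc<c (proj₂ (proj₁ (support hr c v ev)))
            (_ , ew) = filled hr (suc hc) right-inside (>⇒≢ (n<1+n hc) ∘ proj₂)
        in ⊥-elim (nothing≢just (trans (sym right-empty) ew))

  close-hole : S (suc hr) hc ≡ nothing → IsFilling bound (set S hr hc nothing) (overwrite outer hr hc) inner
  close-hole below-empty = record
    { outer-decreasing = outer′-decreasing
    ; inner-decreasing = inner-decreasing
    ; inner≤outer      = inner≤outer′
    ; outer≤bound      = λ r → ≤-trans (outer′≤outer r) (outer≤bound r)
    ; filled           = filled′
    ; support          = support′
    ; ordered          = λ r c r' c' u v eu ev → ordered r c r' c' u v (trans (sym (unchanged r c)) eu) (trans (sym (unchanged r' c')) ev)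
    ; injective        = λ r c r' c' v eu ev → injective r c r' c' v (trans (sym (unchanged r c)) eu) (trans (sym (unchanged r' c')) ev)
    }
    where
    outer′ = overwrite outer hr hc
    unchanged = set-empty-cell S hr hc hole-empty

    outer-below-hole : outer (suc hr) ≤ hc
    outer-below-hole = ≮⇒≥ λ hc<outer →
      let (_ , ev) = filled (suc hr) hc (≤-trans (inner-decreasing hr) (proj₁ hole-inside) , hc<outer) (>⇒≢ (n<1+n hr) ∘ proj₁)
      in nothing≢just (trans (sym below-empty) ev)

    outer′≤outer : ∀ r → outer′ r ≤ outer r
    outer′≤outer r with r ≟ hr
    ... | yes refl = subst (_≤ outer r) (sym (overwrite-≡ outer r hc)) (<⇒≤ (proj₂ hole-inside))
    ... | no  r≢hr = ≤-reflexive (overwrite-≢ outer hr hc r r≢hr)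

    outer′-decreasing : IsDecreasing outer′
    outer′-decreasing r with r ≟ hr | suc r ≟ hr
    ... | yes refl | _ =
          subst₂ _≤_ (sym (overwrite-≢ outer r hc (suc r) (>⇒≢ (n<1+n r)))) (sym (overwrite-≡ outer r hc)) outer-below-hole
    ... | no r≢hr | yes refl = subst₂ _≤_ (sym (overwrite-≡ outer (suc r) hc)) (sym (overwrite-≢ outer (suc r) hc r r≢hr))
                                 (≤-trans (<⇒≤ (proj₂ hole-inside)) (outer-decreasing r))
    ... | no r≢hr | no 1+r≢hr = subst₂ _≤_ (sym (overwrite-≢ outer hr hc (suc r) 1+r≢hr)) (sym (overwrite-≢ outer hr hc r r≢hr))
                                  (outer-decreasing r)

    inner≤outer′ : ∀ r → inner r ≤ outer′ r
    inner≤outer′ r with r ≟ hr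
    ... | yes refl = subst (inner r ≤_) (sym (overwrite-≡ outer r hc)) (proj₁ hole-inside)
    ... | no  r≢hr = subst (inner r ≤_) (sym (overwrite-≢ outer hr hc r r≢hr)) (inner≤outer r)

    filled′ : ∀ r c → InShape outer′ inner r c → ∃[ v ] set S hr hc nothing r c ≡ just v
    filled′ r c (inner≤c , c<outer′) with r ≟ hr
    ... | yes refl =
          let c<hc = subst (c <_) (overwrite-≡ outer r hc) c<outer′
              (v , ev) = filled r c (inner≤c , <-trans c<hc (proj₂ hole-inside)) (<⇒≢ c<hc ∘ proj₂)
          in v , trans (unchanged r c) ev
    ... | no r≢hr =
          let (v , ev) = filled r c (inner≤c , subst (c <_) (overwrite-≢ outer hr hc r r≢hr) c<outer′) (r≢hr ∘ proj₁)
          in v , trans (unchanged r c) ev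

    support′ : ∀ r c v → set S hr hc nothing r c ≡ just v → InShape outer′ inner r c
    support′ r c v ev with support r c v (trans (sym (unchanged r c)) ev) | r ≟ hr
    ... | (inner≤c , _) , _ | yes refl =
          inner≤c , subst (c <_) (sym (overwrite-≡ outer r hc))
                      (≰⇒> λ hc≤c → nothing≢just (trans (sym (row-empty-from-hole c hc≤c)) (trans (sym (unchanged r c)) ev)))
    ... | (inner≤c , c<outer) , _ | no r≢hr = inner≤c , subst (c <_) (sym (overwrite-≢ outer hr hc r r≢hr)) c<outer

-- Jeu-de-taquin steps

ChoosesRight : Tab → ℕ → ℕ → ℕ → Set
ChoosesRight S r c x = S (suc r) c ≡ nothing ⊎ ∃[ y ] (S (suc r) c ≡ just y × x < y)

ChoosesDown : Tab → ℕ → ℕ → ℕ → Set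
ChoosesDown S r c y = S r (suc c) ≡ nothing ⊎ ∃[ x ] (S r (suc c) ≡ just x × y ≤ x)

module _ {bound : ℕ → ℕ} {S : Tab} {outer inner : ℕ → ℕ} {hr hc : ℕ}
  (H : IsHoleFilling bound S outer inner hr hc) where
  open IsHoleFilling H

  slide-right-filling : ∀ {x} → S hr (suc hc) ≡ just x → ChoosesRight S hr hc x
                      → IsHoleFilling bound (move S hr (suc hc) hr hc) outer inner hr (suc hc)
  slide-right-filling {x} ex choice =
    move-into-hole H ex ≤-refl (n≤1+n hc) (λ p → 1+n≢n (proj₂ p)) (x-minimal choice)
    where
    x-minimal : ChoosesRight S hr hc x → ∀ r c v → S r c ≡ just v → hr ≤ r → hc ≤ c
              → ¬ (r ≡ hr × c ≡ hc) → ¬ (r ≡ hr × c ≡ suc hc) → x < v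
    x-minimal choice r c v ev hr≤r hc≤c ¬hole ¬src with m≤n⇒m<n∨m≡n hc≤c
    ... | inj₁ hc<c = ordered hr (suc hc) r c x v ex ev hr≤r hc<c
                        (+-mono-≤-≢⇒< hr≤r hc<c (λ (p , q) → ¬src (sym p , sym q)))
    ... | inj₂ refl with m≤n⇒m<n∨m≡n hr≤r | choice
    ...   | inj₂ refl | _ = ⊥-elim (¬hole (refl , refl))
    ...   | inj₁ hr<r | inj₂ (y , ey , x<y) = <-≤-trans x<y (ordered⇒≤ ordered (suc hr) hc r hc y v ey ev hr<r ≤-refl)
    ...   | inj₁ hr<r | inj₁ below-empty =
            let below-inside = ≤-trans (inner-decreasing hr) (proj₁ hole-inside)
                               , <-≤-trans (proj₂ (proj₁ (support r hc v ev))) (decreasing⇒antitone outer-decreasing hr<r)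
                (_ , ey) = filled (suc hr) hc below-inside (λ p → 1+n≢n (proj₁ p))
            in ⊥-elim (nothing≢just (trans (sym below-empty) ey))

  slide-down-filling : ∀ {y} → S (suc hr) hc ≡ just y → ChoosesDown S hr hc y
                     → IsHoleFilling bound (move S (suc hr) hc hr hc) outer inner (suc hr) hc
  slide-down-filling {y} ey choice =
    move-into-hole H ey (n≤1+n hr) ≤-refl (λ p → 1+n≢n (proj₁ p)) (y-minimal choice)
    where
    y-minimal : ChoosesDown S hr hc y → ∀ r c v → S r c ≡ just v → hr ≤ r → hc ≤ c
              → ¬ (r ≡ hr × c ≡ hc) → ¬ (r ≡ suc hr × c ≡ hc) → y < v
    y-minimal choice r c v ev hr≤r hc≤c ¬hole ¬src with m≤n⇒m<n∨m≡n hr≤r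
    ... | inj₁ hr<r = ordered (suc hr) hc r c y v ey ev hr<r hc≤c
                        (+-mono-≤-≢⇒< hr<r hc≤c (λ (p , q) → ¬src (sym p , sym q)))
    ... | inj₂ refl with m≤n⇒m<n∨m≡n hc≤c | choice
    ...   | inj₂ refl | _ = ⊥-elim (¬hole (refl , refl))
    ...   | inj₁ hc<c | inj₂ (x , ex , y≤x) =
            let y≢x : ¬ (y ≡ x)
                y≢x y≡x = 1+n≢n (proj₁ (injective (suc hr) hc hr (suc hc) y ey
                                          (subst (λ z → S hr (suc hc) ≡ just z) (sym y≡x) ex)))
            in <-≤-trans (≤∧≢⇒< y≤x y≢x) (ordered⇒≤ ordered hr (suc hc) hr c x v ex ev ≤-refl hc<c)
    ...   | inj₁ hc<c | inj₁ right-empty =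
            let right-inside = ≤-trans (proj₁ hole-inside) (n≤1+n hc) , ≤-<-trans hc<c (proj₂ (proj₁ (support hr c v ev)))
                (_ , ex) = filled hr (suc hc) right-inside (λ p → 1+n≢n (proj₂ p))
            in ⊥-elim (nothing≢just (trans (sym right-empty) ex))

+-suc-shift : ∀ r c f → r + c + suc f ≡ r + suc c + f
+-suc-shift r c f = trans (+-suc (r + c) f) (cong (_+ f) (sym (+-suc r c)))

module _ (P : Tab → ℕ → ℕ → Set) (Q : Tab → Set)
  (step-right : ∀ S r c x → S r (suc c) ≡ just x → ChoosesRight S r c x → P S r c
              → P (move S r (suc c) r c) r (suc c))
  (step-down : ∀ S r c y → S (suc r) c ≡ just y → ChoosesDown S r c y → P S r c
             → P (move S (suc r) c r c) (suc r) c)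
  (finish : ∀ S r c → S r (suc c) ≡ nothing → S (suc r) c ≡ nothing → P S r c → Q (set S r c nothing))
  (B : ℕ) (hole-bound : ∀ S r c → P S r c → r + c < B) where

  -- Every step increases r + c, which stays below B; hence the fuel never runs out.
  slide-induction : ∀ fuel S r c → B ≤ r + c + fuel → P S r c → Q (slide fuel S r c)
  slide-induction zero S r c B≤ p =
    ⊥-elim (<⇒≱ (hole-bound S r c p) (subst (B ≤_) (+-identityʳ (r + c)) B≤))
  slide-induction (suc fuel) S r c B≤ p with S r (suc c) in e-right | S (suc r) c in e-below
  ... | nothing | nothing = finish S r c e-right e-below p
  ... | just x  | nothing = slide-induction fuel _ r (suc c) (≤-trans B≤ (≤-reflexive (+-suc-shift r c fuel)))
                              (step-right S r c x e-right (inj₁ e-below) p)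
  ... | nothing | just y  = slide-induction fuel _ (suc r) c (≤-trans B≤ (≤-reflexive (+-suc (r + c) fuel)))
                              (step-down S r c y e-below (inj₁ e-right) p)
  ... | just x  | just y with x <ᵇ y in x<ᵇy
  ...   | true  = slide-induction fuel _ r (suc c) (≤-trans B≤ (≤-reflexive (+-suc-shift r c fuel)))
                    (step-right S r c x e-right (inj₂ (y , e-below , <ᵇ≡true⇒< x<ᵇy)) p)
  ...   | false = slide-induction fuel _ (suc r) c (≤-trans B≤ (≤-reflexive (+-suc (r + c) fuel)))
                    (step-down S r c y e-below (inj₂ (x , e-right , ≮⇒≥ (<ᵇ≡false⇒≮ x<ᵇy))) p)

module _ {α β : List ℕ} (hα : IsPartition α) (hβ : IsPartition β) {T : Tab} (std : IsStandardSkew α β T) where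
  open IsStandardSkew std

  standard-row-≤ : ∀ r c c' {u v} → c ≤ c' → T r c ≡ just u → T r c' ≡ just v → u ≤ v
  standard-row-≤ r c c' c≤c' eu ev with m≤n⇒m<n∨m≡n c≤c'
  ... | inj₂ refl = ≤-reflexive (just-injective (trans (sym eu) ev))
  standard-row-≤ r c (suc c') _ eu ev | inj₁ c<1+c' =
    let c≤c' = s≤s⁻¹ c<1+c'
        (w , ew) = filled r c' (≤-trans (proj₁ (empty r c _ eu)) c≤c' , <-trans (n<1+n c') (proj₂ (empty r (suc c') _ ev)))
    in ≤-trans (standard-row-≤ r c c' c≤c' eu ew) (<⇒≤ (rowInc r c' _ _ ew ev))

  standard-col-≤ : ∀ r r' c {u v} → r ≤ r' → T r c ≡ just u → T r' c ≡ just v → u ≤ v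
  standard-col-≤ r r' c r≤r' eu ev with m≤n⇒m<n∨m≡n r≤r'
  ... | inj₂ refl = ≤-reflexive (just-injective (trans (sym eu) ev))
  standard-col-≤ r (suc r') c _ eu ev | inj₁ r<1+r' =
    let r≤r' = s≤s⁻¹ r<1+r'
        (w , ew) = filled r' c ( ≤-trans (decreasing⇒antitone hβ r≤r') (proj₁ (empty r c _ eu))
                               , <-≤-trans (proj₂ (empty (suc r') c _ ev)) (hα r'))
    in ≤-trans (standard-col-≤ r r' c r≤r' eu ew) (<⇒≤ (colInc r' c _ _ ew ev))

  standard⇒ordered : IsOrdered T
  standard⇒ordered r c r' c' u v eu ev r≤r' c≤c' lt =
    let (w , ew) = filled r c' ( ≤-trans (proj₁ (empty r c u eu)) c≤c'
                               , <-≤-trans (proj₂ (empty r' c' v ev)) (decreasing⇒antitone hα r≤r'))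
        u≤v = ≤-trans (standard-row-≤ r c c' c≤c' eu ew) (standard-col-≤ r r' c' r≤r' ew ev)
        u≢v : ¬ (u ≡ v)
        u≢v u≡v = let (p , q) = injective r c r' c' u eu (subst (λ z → T r' c' ≡ just z) (sym u≡v) ev)
                  in <-irrefl (cong₂ _+_ p q) lt
    in ≤∧≢⇒< u≤v u≢v

module _ {α β : List ℕ} (hα : IsPartition α) (hβ : IsPartition β) (β⊆α : β ⊆ α) {T : Tab}
  (std : IsStandardSkew α β T) where
  open IsStandardSkew std

  standard-filling : IsFilling (row α) T (row α) (row β)
  standard-filling = record
    { outer-decreasing = hα
    ; inner-decreasing = hβ
    ; inner≤outer      = β⊆α
    ; outer≤bound      = λ _ → ≤-refl
    ; filled           = filled
    ; support          = empty
    ; ordered          = standard⇒ordered hα hβ std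
    ; injective        = injective
    }

-- Barriers left behind by slides

DoesNotSlideDown : Tab → ℕ → ℕ → Set
DoesNotSlideDown S r c =
  S (suc r) c ≡ nothing ⊎ ∃[ u ] ∃[ w ] (S r (suc c) ≡ just u × S (suc r) c ≡ just w × u < w)

DoesNotSlideDown-local : ∀ {S S'} r c → DoesNotSlideDown S r c
  → S' r (suc c) ≡ S r (suc c) → S' (suc r) c ≡ S (suc r) c → DoesNotSlideDown S' r c
DoesNotSlideDown-local r c (inj₁ e) _ e-below = inj₁ (trans e-below e)
DoesNotSlideDown-local r c (inj₂ (u , w , eu , ew , u<w)) e-right e-below =
  inj₂ (u , w , trans e-right eu , trans e-below ew , u<w)

AgreesAfter : Tab → Tab → ℕ → ℕ → Set
AgreesAfter S S₀ hr hc = ∀ r c → (hr < r ⊎ (hr ≡ r × hc < c)) → S r c ≡ S₀ r c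

agreesAfter-right : ∀ {S S₀ hr hc} → AgreesAfter S S₀ hr hc → AgreesAfter (move S hr (suc hc) hr hc) S₀ hr (suc hc)
agreesAfter-right {S} {S₀} {hr} {hc} agree r c (inj₁ hr<r) =
  trans (move-elsewhere S hr (suc hc) hr hc r c (>⇒≢ hr<r ∘ proj₁) (>⇒≢ hr<r ∘ proj₁)) (agree r c (inj₁ hr<r))
agreesAfter-right {S} {S₀} {hr} {hc} agree r c (inj₂ (refl , 1+hc<c)) =
  trans (move-elsewhere S hr (suc hc) hr hc r c (>⇒≢ 1+hc<c ∘ proj₂) (>⇒≢ (<-trans (n<1+n hc) 1+hc<c) ∘ proj₂))
        (agree r c (inj₂ (refl , <-trans (n<1+n hc) 1+hc<c)))

agreesAfter-down : ∀ {S S₀ hr hc} → AgreesAfter S S₀ hr hc → AgreesAfter (move S (suc hr) hc hr hc) S₀ (suc hr) hc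
agreesAfter-down {S} {S₀} {hr} {hc} agree r c (inj₁ 1+hr<r) =
  trans (move-elsewhere S (suc hr) hc hr hc r c (>⇒≢ 1+hr<r ∘ proj₁) (>⇒≢ (<-trans (n<1+n hr) 1+hr<r) ∘ proj₁))
        (agree r c (inj₁ (<-trans (n<1+n hr) 1+hr<r)))
agreesAfter-down {S} {S₀} {hr} {hc} agree r c (inj₂ (refl , hc<c)) =
  trans (move-elsewhere S (suc hr) hc hr hc r c (>⇒≢ hc<c ∘ proj₂) (>⇒≢ (n<1+n hr) ∘ proj₁)) (agree r c (inj₁ (n<1+n hr)))

module Shelter (α β γ : List ℕ) (hα : IsPartition α) (hβ : IsPartition β) (hγ : IsPartition γ)
  (γ⊆β : γ ⊆ β) (strip : ∀ i → row β i ≤ suc (row γ i)) (a j : ℕ) where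

  -- The inner shape once the boxes of β/γ in the rows ≥ i have been slid into.
  innerAfter : ℕ → ℕ → ℕ
  innerAfter i r with r <? i
  ... | yes _ = row β r
  ... | no  _ = row γ r

  innerAfter-above : ∀ {i r} → r < i → innerAfter i r ≡ row β r
  innerAfter-above {i} {r} r<i with r <? i
  ... | yes _   = refl
  ... | no  r≮i = contradiction r<i r≮i

  innerAfter-below : ∀ {i r} → i ≤ r → innerAfter i r ≡ row γ r
  innerAfter-below {i} {r} i≤r with r <? i
  ... | yes r<i = contradiction i≤r (<⇒≱ r<i)
  ... | no  _   = refl

  innerAfter≤β : ∀ i r → innerAfter i r ≤ row β r
  innerAfter≤β i r with r <? i
  ... | yes _ = ≤-refl
  ... | no  _ = γ⊆β r

  innerAfter-decreasing : ∀ i → IsDecreasing (innerAfter i)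
  innerAfter-decreasing i r with suc r <? i | r <? i
  ... | yes _     | yes _   = hβ r
  ... | yes 1+r<i | no  r≮i = contradiction (<-trans (n<1+n r) 1+r<i) r≮i
  ... | no  _     | yes _   = ≤-trans (hγ r) (γ⊆β r)
  ... | no  _     | no  _   = hγ r

  innerAfter-other : ∀ i r → ¬ (r ≡ i) → innerAfter i r ≡ innerAfter (suc i) r
  innerAfter-other i r r≢i with r <? i | r <? suc i
  ... | yes _   | yes _     = refl
  ... | yes r<i | no  r≮1+i = contradiction (<-trans r<i (n<1+n i)) r≮1+i
  ... | no  r≮i | yes r<1+i = contradiction (≤∧≢⇒< (s≤s⁻¹ r<1+i) r≢i) r≮i
  ... | no  _   | no  _     = refl

  -- `path r` is the column at which the hole of a slide left row r, for the rows it visited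
  -- (start ≤ r ≤ end).  A barrier records that a hole placed directly above a box crossed by
  -- that slide (and at most one column left of β) would move right, not down.
  Barrier : Tab → ℕ → ℕ → (ℕ → ℕ) → Set
  Barrier S start end path = ∀ s c → start ≤ suc s → suc s ≤ end
    → (suc s ≡ start ⊎ path s ≤ c) → (c < path (suc s) ⊎ suc s ≡ end)
    → row β s ≤ suc c → DoesNotSlideDown S s c

  -- The same for a slide in progress, whose hole is in row hr.
  PartialBarrier : Tab → ℕ → ℕ → (ℕ → ℕ) → Set
  PartialBarrier S start hr path = ∀ s c → start ≤ suc s → suc s ≤ hr
    → (suc s ≡ start ⊎ path s ≤ c) → c < path (suc s)
    → row β s ≤ suc c → DoesNotSlideDown S s c

  record SmallerOnRight (S : Tab) (ca : ℕ) : Set where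
    constructor smaller-at
    field
      col        : ℕ
      entry      : ℕ
      at         : S j col ≡ just entry
      entry<a    : entry < a
      right-of-a : ca < col

  -- An earlier slide, started between rows i and j, ended above a or crossed row j right of a.
  record Sheltered (S : Tab) (i ca : ℕ) : Set where
    constructor sheltered
    field
      start end   : ℕ
      path        : ℕ → ℕ
      i≤start     : i ≤ start
      start≤j     : start ≤ j
      start≤end   : start ≤ end
      barrier     : Barrier S start end path
      left-of-path : end ≤ j ⊎ (j < end × ca < path j)

  record LocatedBelowJ (S : Tab) (Guard : ℕ → Set) : Set where
    constructor located
    field
      aRow aCol : ℕ
      a-at      : S aRow aCol ≡ just a
      j<aRow    : j < aRow
      guard     : Guard aCol

  record Invariant (i : ℕ) (S : Tab) : Set where
    constructor invariant
    field
      outer   : ℕ → ℕ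
      filling : IsFilling (row α) S outer (innerAfter i)
      a-below : LocatedBelowJ S (λ ca → SmallerOnRight S ca ⊎ Sheltered S i ca)

  module _ {i : ℕ} {S : Tab} {outer : ℕ → ℕ} {hr hc : ℕ} {path : ℕ → ℕ}
    (H : IsHoleFilling (row α) S outer (innerAfter i) hr hc)
    (path-at-hole : path hr ≡ hc) (partial : PartialBarrier S i hr path) where
    open IsHoleFilling H

    partialBarrier-right : ∀ {x} → S hr (suc hc) ≡ just x
                         → PartialBarrier (move S hr (suc hc) hr hc) i hr (overwrite path hr (suc hc))
    partialBarrier-right {x} ex s c i≤1+s 1+s≤hr from upto β≤ with suc s ≟ hr
    ... | no 1+s≢hr =
          DoesNotSlideDown-local {S} {move S hr (suc hc) hr hc} s c
            (partial s c i≤1+s 1+s≤hr (map₂ (subst (_≤ c) (overwrite-≢ path hr (suc hc) s (<⇒≢ 1+s≤hr))) from)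
                     (subst (c <_) (overwrite-≢ path hr (suc hc) (suc s) 1+s≢hr) upto) β≤)
            (move-elsewhere S hr (suc hc) hr hc s (suc c) (<⇒≢ 1+s≤hr ∘ proj₁) (<⇒≢ 1+s≤hr ∘ proj₁))
            (move-elsewhere S hr (suc hc) hr hc (suc s) c (1+s≢hr ∘ proj₁) (1+s≢hr ∘ proj₁))
    ... | yes 1+s≡hr
        with m≤n⇒m<n∨m≡n (s≤s⁻¹ (subst (c <_) (trans (cong (overwrite path hr (suc hc)) 1+s≡hr)
                                                      (overwrite-≡ path hr (suc hc))) upto))
    ...   | inj₁ c<hc =
            DoesNotSlideDown-local {S} {move S hr (suc hc) hr hc} s c
              (partial s c i≤1+s 1+s≤hr (map₂ (subst (_≤ c) (overwrite-≢ path hr (suc hc) s (<⇒≢ 1+s≤hr))) from)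
                       (subst (c <_) (sym (trans (cong path 1+s≡hr) path-at-hole)) c<hc) β≤)
              (move-elsewhere S hr (suc hc) hr hc s (suc c) (<⇒≢ 1+s≤hr ∘ proj₁) (<⇒≢ 1+s≤hr ∘ proj₁))
              (move-elsewhere S hr (suc hc) hr hc (suc s) c (<⇒≢ (<-trans c<hc (n<1+n hc)) ∘ proj₂) (<⇒≢ c<hc ∘ proj₂))
    ...   | inj₂ refl =
            let s≤hr = <⇒≤ 1+s≤hr
                above-inside = ≤-trans (innerAfter≤β i s) β≤
                             , <-≤-trans (proj₂ (proj₁ (support hr (suc c) x ex))) (decreasing⇒antitone outer-decreasing s≤hr)
                (u , eu) = filled s (suc c) above-inside (<⇒≢ 1+s≤hr ∘ proj₁)
                x-below : move S hr (suc c) hr c (suc s) c ≡ just x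
                x-below = trans (cong (λ r → move S hr (suc c) hr c r c) 1+s≡hr)
                                (trans (move-target S hr (suc c) hr c (<⇒≢ (n<1+n c) ∘ proj₂)) ex)
            in inj₂ ( u , x
                    , trans (move-elsewhere S hr (suc c) hr c s (suc c) (<⇒≢ 1+s≤hr ∘ proj₁) (<⇒≢ 1+s≤hr ∘ proj₁)) eu
                    , x-below
                    , ordered s (suc c) hr (suc c) u x eu ex s≤hr ≤-refl (+-monoˡ-< (suc c) 1+s≤hr))

    partialBarrier-down : ∀ {y} → i ≤ hr → S (suc hr) hc ≡ just y
                        → PartialBarrier (move S (suc hr) hc hr hc) i (suc hr) (overwrite path (suc hr) hc)
    partialBarrier-down {y} i≤hr ey s c i≤1+s 1+s≤1+hr from upto β≤ with s ≟ hr
    ... | yes refl =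
          let c<hc = subst (c <_) (overwrite-≡ path (suc s) hc) upto
              path≤c : suc s ≡ i ⊎ path s ≤ c → hc ≤ c
              path≤c = λ { (inj₁ 1+s≡i) → ⊥-elim (1+n≰n (subst (_≤ s) (sym 1+s≡i) i≤hr))
                         ; (inj₂ path≤c) → subst (_≤ c) path-at-hole path≤c }
          in ⊥-elim (<⇒≱ c<hc (path≤c (map₂ (subst (_≤ c) (overwrite-≢ path (suc s) hc s (<⇒≢ (n<1+n s)))) from)))
    ... | no s≢hr =
          let 1+s≤hr = ≤∧≢⇒< (s≤s⁻¹ 1+s≤1+hr) s≢hr
              upto′ = subst (c <_) (overwrite-≢ path (suc hr) hc (suc s) (<⇒≢ (s≤s 1+s≤hr))) upto
              not-hole : ¬ (suc s ≡ hr × c ≡ hc)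
              not-hole = λ (1+s≡hr , c≡hc) → <⇒≢ (subst (c <_) (trans (cong path 1+s≡hr) path-at-hole) upto′) c≡hc
          in DoesNotSlideDown-local {S} {move S (suc hr) hc hr hc} s c
               (partial s c i≤1+s 1+s≤hr
                        (map₂ (subst (_≤ c) (overwrite-≢ path (suc hr) hc s (<⇒≢ (<-trans 1+s≤hr (n<1+n hr))))) from) upto′ β≤)
               (move-elsewhere S (suc hr) hc hr hc s (suc c) (<⇒≢ (<-trans 1+s≤hr (n<1+n hr)) ∘ proj₁) (s≢hr ∘ proj₁))
               (move-elsewhere S (suc hr) hc hr hc (suc s) c (<⇒≢ (s≤s 1+s≤hr) ∘ proj₁) not-hole)

  module SlideInto (i : ℕ) (S₀ : Tab) where

    -- The hole of the slide into row i has gone through row j to the right of a.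
    data Passed (hr hc : ℕ) (path : ℕ → ℕ) (ca : ℕ) : Set where
      in-row-j : hr ≡ j → ca < hc → Passed hr hc path ca
      below-j  : j < hr → ca < path j → Passed hr hc path ca

    -- The shelter of an earlier slide, seen from the slide into row i: the boxes its hole has not
    -- reached yet are as in S₀, and the hole stays weakly right of the old path.
    record ShelteredDuring (S : Tab) (hr hc : ℕ) (path : ℕ → ℕ) (ca : ℕ) : Set where
      constructor sheltered-during
      field
        start end        : ℕ
        path₀            : ℕ → ℕ
        i<start          : i < start
        start≤j          : start ≤ j
        start≤end        : start ≤ end
        barrier          : Barrier S₀ start end path₀
        unchanged        : AgreesAfter S S₀ hr hc
        hr<end           : hr < end
        right-of-barrier : start ≤ hr → path₀ hr ≤ hc
        left-of-paths    : end ≤ j ⊎ (j < end × ca < path₀ j × (j < hr → ca < path j))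

      barrier-left-of-hole : j ≡ hr → path₀ j ≤ hc
      barrier-left-of-hole j≡hr = subst (_≤ hc) (cong path₀ (sym j≡hr)) (right-of-barrier (subst (start ≤_) j≡hr start≤j))

    data Protected (S : Tab) (hr hc : ℕ) (path : ℕ → ℕ) (ca : ℕ) : Set where
      smaller  : SmallerOnRight S ca → Protected S hr hc path ca
      passed   : i ≤ j → Passed hr hc path ca → Protected S hr hc path ca
      shielded : ShelteredDuring S hr hc path ca → Protected S hr hc path ca

    record SlideState (S : Tab) (hr hc : ℕ) : Set where
      field
        outer path   : ℕ → ℕ
        filling      : IsHoleFilling (row α) S outer (innerAfter i) hr hc
        i≤hr         : i ≤ hr
        path-at-hole : path hr ≡ hc
        partial      : PartialBarrier S i hr path
        a-below      : LocatedBelowJ S (Protected S hr hc path)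

    state-start : Invariant (suc i) S₀ → row γ i < row β i → SlideState S₀ i (row β i ∸ 1)
    state-start inv γ<β = record
      { outer        = outer
      ; path         = λ _ → row β i ∸ 1
      ; filling      = open-hole filling (innerAfter-decreasing i) (innerAfter-other i)
                         (trans (innerAfter-below ≤-refl) γ≡β∸1)
                         (trans (innerAfter-above (n<1+n i)) β≡1+[β∸1])
      ; i≤hr         = ≤-refl
      ; path-at-hole = refl
      ; partial      = partial
      ; a-below      = located aRow aCol a-at j<aRow (protection guard)
      }
      where
      open Invariant inv
      open LocatedBelowJ a-below
      β≡1+γ : row β i ≡ suc (row γ i)
      β≡1+γ = ≤-antisym (strip i) γ<β
      γ≡β∸1 : row γ i ≡ row β i ∸ 1
      γ≡β∸1 = cong (_∸ 1) (sym β≡1+γ)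
      β≡1+[β∸1] : row β i ≡ suc (row β i ∸ 1)
      β≡1+[β∸1] = trans β≡1+γ (cong suc γ≡β∸1)

      partial : PartialBarrier S₀ i i (λ _ → row β i ∸ 1)
      partial s c i≤1+s 1+s≤i _ c<β∸1 β≤ =
        let 1+s≡i = ≤-antisym 1+s≤i i≤1+s
            βi≤1+c = ≤-trans (subst (λ r → row β r ≤ row β s) 1+s≡i (hβ s)) β≤
        in contradiction (subst (_≤ suc c) β≡1+[β∸1] βi≤1+c) (<⇒≱ (s≤s c<β∸1))

      protection : ∀ {ca} → SmallerOnRight S₀ ca ⊎ Sheltered S₀ (suc i) ca
                 → Protected S₀ i (row β i ∸ 1) (λ _ → row β i ∸ 1) ca
      protection (inj₁ w) = smaller w
      protection (inj₂ (sheltered start end path i<start start≤j start≤end barrier left)) =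
        shielded (sheltered-during start end path i<start start≤j start≤end barrier (λ _ _ _ → refl)
                   (<-≤-trans i<start start≤end) (λ start≤i → contradiction start≤i (<⇒≱ i<start))
                   (map₂ (λ (j<end , ca<path) → j<end , ca<path , λ j<i → contradiction (<-trans j<i i<start) (≤⇒≯ start≤j))
                         left))

    module _ {S : Tab} {hr hc : ℕ} (st : SlideState S hr hc) where
      open SlideState st
      open IsHoleFilling filling
      open LocatedBelowJ a-below

      state-right : ∀ {x} → S hr (suc hc) ≡ just x → ChoosesRight S hr hc x
                  → SlideState (move S hr (suc hc) hr hc) hr (suc hc)
      state-right {x} ex choice = record
        { outer        = outer
        ; path         = path′
        ; filling      = slide-right-filling filling ex choice
        ; i≤hr         = i≤hr
        ; path-at-hole = overwrite-≡ path hr (suc hc)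
        ; partial      = partialBarrier-right filling path-at-hole partial ex
        ; a-below      = a-below′
        }
        where
        S′ = move S hr (suc hc) hr hc
        path′ = overwrite path hr (suc hc)

        ¬src : ¬ (hr ≡ hr × hc ≡ suc hc)
        ¬src = <⇒≢ (n<1+n hc) ∘ proj₂

        path′-above : j < hr → path′ j ≡ path j
        path′-above j<hr = overwrite-≢ path hr (suc hc) j (<⇒≢ j<hr)

        passed-right : ∀ {ca ca'} → ca' ≤ ca → Passed hr hc path ca → Passed hr (suc hc) path′ ca'
        passed-right ca'≤ca (in-row-j hr≡j ca<hc) = in-row-j hr≡j (<-trans (≤-<-trans ca'≤ca ca<hc) (n<1+n hc))
        passed-right ca'≤ca (below-j j<hr ca<path) =
          below-j j<hr (subst (_ <_) (sym (path′-above j<hr)) (≤-<-trans ca'≤ca ca<path))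

        sheltered-right : ∀ {ca ca'} → ca' ≤ ca → ShelteredDuring S hr hc path ca → ShelteredDuring S′ hr (suc hc) path′ ca'
        sheltered-right {ca' = ca'} ca'≤ca sh =
          sheltered-during start end path₀ i<start start≤j start≤end barrier (agreesAfter-right unchanged) hr<end
            (λ start≤hr → ≤-trans (right-of-barrier start≤hr) (n≤1+n hc))
            (map₂ (λ (j<end , ca<path₀ , ca<path) →
                     j<end , ≤-<-trans ca'≤ca ca<path₀
                     , λ j<hr → subst (ca' <_) (sym (path′-above j<hr)) (≤-<-trans ca'≤ca (ca<path j<hr)))
                  left-of-paths)
          where open ShelteredDuring sh

        protection-a-moved : Protected S hr hc path (suc hc) → S hr (suc hc) ≡ just a → Protected S′ hr (suc hc) path′ hc
        protection-a-moved (smaller (smaller-at cb y ey y<a 1+hc<cb)) ea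
          with move-tracks-entry S hr (suc hc) hr hc j cb y hole-empty ¬src ey
        ... | inj₁ (j≡hr , cb≡1+hc , _) =
              contradiction (just-injective (trans (sym ey) (trans (cong₂ S j≡hr cb≡1+hc) ea))) (<⇒≢ y<a)
        ... | inj₂ (_ , ey′) = smaller (smaller-at cb y ey′ y<a (<-trans (n<1+n hc) 1+hc<cb))
        protection-a-moved (passed i≤j p) _ = passed i≤j (passed-right (n≤1+n hc) p)
        protection-a-moved (shielded sh) _ = shielded (sheltered-right (n≤1+n hc) sh)

        protection-a-stays : ∀ {ca} → Protected S hr hc path ca → Protected S′ hr (suc hc) path′ ca
        protection-a-stays {ca} (smaller (smaller-at cb y ey y<a ca<cb))
          with move-tracks-entry S hr (suc hc) hr hc j cb y hole-empty ¬src ey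
        ... | inj₁ (j≡hr , cb≡1+hc , _) =
              passed (subst (i ≤_) (sym j≡hr) i≤hr) (in-row-j (sym j≡hr) (subst (ca <_) cb≡1+hc ca<cb))
        ... | inj₂ (_ , ey′) = smaller (smaller-at cb y ey′ y<a ca<cb)
        protection-a-stays (passed i≤j p) = passed i≤j (passed-right ≤-refl p)
        protection-a-stays (shielded sh) = shielded (sheltered-right ≤-refl sh)

        a-below′ : LocatedBelowJ S′ (Protected S′ hr (suc hc) path′)
        a-below′ with move-tracks-entry S hr (suc hc) hr hc aRow aCol a hole-empty ¬src a-at
        ... | inj₁ (aRow≡hr , aCol≡1+hc , a-at′) =
              located hr hc a-at′ (subst (j <_) aRow≡hr j<aRow)
                (protection-a-moved (subst (Protected S hr hc path) aCol≡1+hc guard) (trans (sym (cong₂ S aRow≡hr aCol≡1+hc)) a-at))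
        ... | inj₂ (_ , a-at′) = located aRow aCol a-at′ j<aRow (protection-a-stays guard)

      state-down : ∀ {y} → S (suc hr) hc ≡ just y → ChoosesDown S hr hc y
                 → SlideState (move S (suc hr) hc hr hc) (suc hr) hc
      state-down {y} ey choice = record
        { outer        = outer
        ; path         = path′
        ; filling      = slide-down-filling filling ey choice
        ; i≤hr         = ≤-trans i≤hr (n≤1+n hr)
        ; path-at-hole = overwrite-≡ path (suc hr) hc
        ; partial      = partialBarrier-down filling path-at-hole partial i≤hr ey
        ; a-below      = a-below′
        }
        where
        S′ = move S (suc hr) hc hr hc
        path′ = overwrite path (suc hr) hc

        ¬src : ¬ (hr ≡ suc hr × hc ≡ hc)
        ¬src = <⇒≢ (n<1+n hr) ∘ proj₁

        path′-above : j ≤ hr → path′ j ≡ path j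
        path′-above j≤hr = overwrite-≢ path (suc hr) hc j (<⇒≢ (s≤s j≤hr))

        -- The only use of the strip hypothesis: the hole lies right of γ in its row, hence at most
        -- one column left of β.
        β≤1+hc : row β hr ≤ suc hc
        β≤1+hc = ≤-trans (strip hr) (s≤s (subst (_≤ hc) (innerAfter-below i≤hr) (proj₁ hole-inside)))

        module _ {ca} (sh : ShelteredDuring S hr hc path ca) where
          open ShelteredDuring sh

          not-onto-barrier : start ≤ suc hr → hc < path₀ (suc hr) ⊎ suc hr ≡ end → ⊥
          not-onto-barrier start≤1+hr upto with DoesNotSlideDown-local {S₀} {S} hr hc
                 (barrier hr hc start≤1+hr hr<end from upto β≤1+hc)
                 (unchanged hr (suc hc) (inj₂ (refl , n<1+n hc))) (unchanged (suc hr) hc (inj₁ (n<1+n hr)))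
            where
            from : suc hr ≡ start ⊎ path₀ hr ≤ hc
            from with start ≤? hr
            ... | yes start≤hr = inj₂ (right-of-barrier start≤hr)
            ... | no  start≰hr = inj₁ (≤-antisym (≰⇒> start≰hr) start≤1+hr)
          ... | inj₁ below-empty = nothing≢just (trans (sym below-empty) ey)
          ... | inj₂ (u , w , eu , ew , u<w) = case choice of λ
                  { (inj₁ right-empty) → nothing≢just (trans (sym right-empty) eu)
                  ; (inj₂ (x , ex , y≤x)) →
                      <⇒≱ (subst₂ _<_ (just-injective (trans (sym eu) ex)) (just-injective (trans (sym ew) ey)) u<w) y≤x }

          stays-above-barrier : suc hr < end × (start ≤ suc hr → path₀ (suc hr) ≤ hc)
          stays-above-barrier with start ≤? suc hr
          ... | no start≰1+hr = <-≤-trans (≰⇒> start≰1+hr) start≤end , λ start≤1+hr → contradiction start≤1+hr start≰1+hr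
          ... | yes start≤1+hr with suc hr ≟ end | hc <? path₀ (suc hr)
          ...   | yes 1+hr≡end | _      = ⊥-elim (not-onto-barrier start≤1+hr (inj₂ 1+hr≡end))
          ...   | no  _        | yes hc<path₀ = ⊥-elim (not-onto-barrier start≤1+hr (inj₁ hc<path₀))
          ...   | no  1+hr≢end | no  hc≮path₀ = ≤∧≢⇒< hr<end 1+hr≢end , λ _ → ≮⇒≥ hc≮path₀

          sheltered-down : ShelteredDuring S′ (suc hr) hc path′ ca
          sheltered-down =
            sheltered-during start end path₀ i<start start≤j start≤end barrier (agreesAfter-down unchanged)
              (proj₁ stays-above-barrier) (proj₂ stays-above-barrier) (map₂ left-of-path′ left-of-paths)
            where
            left-of-path′ : j < end × ca < path₀ j × (j < hr → ca < path j)
                          → j < end × ca < path₀ j × (j < suc hr → ca < path′ j)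
            left-of-path′ (j<end , ca<path₀ , ca<path) = j<end , ca<path₀ , λ j<1+hr → case j <? hr of λ
              { (yes j<hr) → subst (ca <_) (sym (path′-above (<⇒≤ j<hr))) (ca<path j<hr)
              ; (no  j≮hr) → let j≡hr = ≤-antisym (s≤s⁻¹ j<1+hr) (≮⇒≥ j≮hr) in
                  subst (ca <_) (sym (trans (path′-above (s≤s⁻¹ j<1+hr)) (trans (cong path j≡hr) path-at-hole)))
                    (<-≤-trans ca<path₀ (barrier-left-of-hole j≡hr)) }

        protection-down : ∀ {ca} → Protected S hr hc path ca → Protected S′ (suc hr) hc path′ ca
        protection-down {ca} (smaller (smaller-at cb y′ ey′ y′<a ca<cb))
          with move-tracks-entry S (suc hr) hc hr hc j cb y′ hole-empty ¬src ey′
        ... | inj₁ (j≡1+hr , cb≡hc , _) =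
              passed (subst (i ≤_) (sym j≡1+hr) (≤-trans i≤hr (n≤1+n hr))) (in-row-j (sym j≡1+hr) (subst (ca <_) cb≡hc ca<cb))
        ... | inj₂ (_ , ey″) = smaller (smaller-at cb y′ ey″ y′<a ca<cb)
        protection-down {ca} (passed i≤j (in-row-j hr≡j ca<hc)) =
          passed i≤j (below-j (subst (_< suc hr) hr≡j (n<1+n hr))
                             (subst (ca <_) (sym (trans (path′-above (≤-reflexive (sym hr≡j)))
                                                        (trans (cong path (sym hr≡j)) path-at-hole))) ca<hc))
        protection-down {ca} (passed i≤j (below-j j<hr ca<path)) =
          passed i≤j (below-j (<-trans j<hr (n<1+n hr)) (subst (ca <_) (sym (path′-above (<⇒≤ j<hr))) ca<path))
        protection-down (shielded sh) = shielded (sheltered-down sh)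

        -- A hole in row j directly above a would see a smaller entry to its right.
        a-stays-below-j : S (suc hr) hc ≡ just a → j ≤ hr → Protected S hr hc path hc → j < hr
        a-stays-below-j ea j≤hr prot with j ≟ hr
        ... | no  j≢hr = ≤∧≢⇒< j≤hr j≢hr
        ... | yes j≡hr = ⊥-elim (impossible prot)
          where
          impossible : Protected S hr hc path hc → ⊥
          impossible (smaller (smaller-at cb y′ ey′ y′<a hc<cb)) =
            let right-inside = ≤-trans (subst (λ r → innerAfter i r ≤ hc) (sym j≡hr) (proj₁ hole-inside)) (n≤1+n hc)
                             , <-≤-trans (s≤s hc<cb) (proj₂ (proj₁ (support j cb y′ ey′)))
                (w , ew) = filled j (suc hc) right-inside (>⇒≢ (n<1+n hc) ∘ proj₂)
                w≤y′ = ordered⇒≤ ordered j (suc hc) j cb w y′ ew ey′ ≤-refl hc<cb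
                ew′ = subst (λ r → S r (suc hc) ≡ just w) j≡hr ew
            in case choice of λ
              { (inj₁ right-empty) → nothing≢just (trans (sym right-empty) ew′)
              ; (inj₂ (x , ex , y≤x)) →
                  let a≤w = subst₂ _≤_ (just-injective (trans (sym ey) ea)) (just-injective (trans (sym ex) ew′)) y≤x
                  in <⇒≱ y′<a (≤-trans a≤w w≤y′) }
          impossible (passed _ (in-row-j _ hc<hc)) = <-irrefl refl hc<hc
          impossible (passed _ (below-j j<hr _)) = <-irrefl j≡hr j<hr
          impossible (shielded sh) with ShelteredDuring.left-of-paths sh
          ... | inj₁ end≤j = <-irrefl refl (<-≤-trans (ShelteredDuring.hr<end sh) (subst (_ ≤_) j≡hr end≤j))
          ... | inj₂ (_ , hc<path₀ , _) = <-irrefl refl (<-≤-trans hc<path₀ (ShelteredDuring.barrier-left-of-hole sh j≡hr))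

        a-below′ : LocatedBelowJ S′ (Protected S′ (suc hr) hc path′)
        a-below′ with move-tracks-entry S (suc hr) hc hr hc aRow aCol a hole-empty ¬src a-at
        ... | inj₁ (aRow≡1+hr , aCol≡hc , a-at′) =
              let prot = subst (Protected S hr hc path) aCol≡hc guard
              in located hr hc a-at′
                   (a-stays-below-j (trans (sym (cong₂ S aRow≡1+hr aCol≡hc)) a-at) (s≤s⁻¹ (subst (j <_) aRow≡1+hr j<aRow)) prot)
                   (protection-down prot)
        ... | inj₂ (_ , a-at′) = located aRow aCol a-at′ j<aRow (protection-down guard)

    state-finish : ∀ S hr hc → S hr (suc hc) ≡ nothing → S (suc hr) hc ≡ nothing → SlideState S hr hc
                 → Invariant i (set S hr hc nothing)
    state-finish S hr hc right-empty below-empty st =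
      invariant (overwrite outer hr hc) (close-hole filling right-empty below-empty)
        (located aRow aCol (trans (unchanged aRow aCol) a-at) j<aRow (protection guard))
      where
      open SlideState st
      open IsHoleFilling filling
      open LocatedBelowJ a-below
      S′ = set S hr hc nothing
      unchanged = set-empty-cell S hr hc hole-empty

      barrier : Barrier S′ i hr path
      barrier s c i≤1+s 1+s≤hr from upto β≤ with c <? path (suc s)
      ... | yes c<path = DoesNotSlideDown-local {S} {S′} s c (partial s c i≤1+s 1+s≤hr from c<path β≤)
                           (unchanged s (suc c)) (unchanged (suc s) c)
      ... | no  c≮path = case upto of λ
            { (inj₁ c<path) → contradiction c<path c≮path
            ; (inj₂ 1+s≡hr) → inj₁ (trans (unchanged (suc s) c) (subst (λ r → S r c ≡ nothing) (sym 1+s≡hr)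
                                 (row-empty-from-hole filling right-empty c
                                   (subst (_≤ c) (trans (cong path 1+s≡hr) path-at-hole) (≮⇒≥ c≮path))))) }

      -- Once a slide has passed a, its own path is the new barrier.
      protection : ∀ {ca} → Protected S hr hc path ca → SmallerOnRight S′ ca ⊎ Sheltered S′ i ca
      protection (smaller (smaller-at cb y ey y<a ca<cb)) = inj₁ (smaller-at cb y (trans (unchanged j cb) ey) y<a ca<cb)
      protection (passed i≤j (in-row-j hr≡j _)) =
        inj₂ (sheltered i hr path ≤-refl i≤j i≤hr barrier (inj₁ (≤-reflexive hr≡j)))
      protection (passed i≤j (below-j j<hr ca<path)) =
        inj₂ (sheltered i hr path ≤-refl i≤j i≤hr barrier (inj₂ (j<hr , ca<path)))
      protection {ca} (shielded (sheltered-during _ end _ i<start start≤j _ _ _ hr<end _ left-of-paths)) =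
        inj₂ (sheltered i hr path ≤-refl (<⇒≤ (<-≤-trans i<start start≤j)) i≤hr barrier left-of-path)
        where
        left-of-path : hr ≤ j ⊎ (j < hr × ca < path j)
        left-of-path with j <? hr
        ... | no  j≮hr = inj₁ (≮⇒≥ j≮hr)
        ... | yes j<hr = case left-of-paths of λ
              { (inj₁ end≤j)             → inj₁ (≤-trans (<⇒≤ hr<end) end≤j)
              ; (inj₂ (_ , _ , ca<path)) → inj₂ (j<hr , ca<path j<hr) }

  slideRow-invariant : ∀ i S → Invariant (suc i) S → Invariant i (slideRow α β γ i S)
  slideRow-invariant i S inv with row γ i <ᵇ row β i in γ<ᵇβ
  ... | true =
        slide-induction SlideState (Invariant i)
          (λ _ _ _ _ ex choice st → state-right st ex choice)
          (λ _ _ _ _ ey choice st → state-down st ey choice)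
          state-finish
          (size α) hole-bound (suc (size α)) S i (row β i ∸ 1) (≤-trans (n≤1+n _) (m≤n+m _ _))
          (state-start inv (<ᵇ≡true⇒< γ<ᵇβ))
    where
    open SlideInto i S
    hole-bound : ∀ S′ r c → SlideState S′ r c → r + c < size α
    hole-bound S′ r c st = row+col<size α hα r c (<-≤-trans (proj₂ hole-inside) (outer≤bound r))
      where open IsHoleFilling (SlideState.filling st)
  ... | false = invariant outer (IsFilling-inner-cong inner-same filling) (located aRow aCol a-at j<aRow (map₂ widen guard))
    where
    open Invariant inv
    open LocatedBelowJ a-below
    γ≡β : row γ i ≡ row β i
    γ≡β = ≤-antisym (γ⊆β i) (≮⇒≥ (<ᵇ≡false⇒≮ γ<ᵇβ))
    inner-same : ∀ r → innerAfter (suc i) r ≡ innerAfter i r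
    inner-same r with r ≟ i
    ... | yes refl = trans (innerAfter-above (n<1+n r)) (sym (trans (innerAfter-below ≤-refl) γ≡β))
    ... | no  r≢i  = sym (innerAfter-other i r r≢i)
    widen : ∀ {ca} → Sheltered S (suc i) ca → Sheltered S i ca
    widen (sheltered start end path 1+i≤start start≤j start≤end barrier left) =
      sheltered start end path (≤-trans (n≤1+n i) 1+i≤start) start≤j start≤end barrier left

  slidesUp-invariant : ∀ n S → Invariant n S → Invariant 0 (slidesUp α β γ n S)
  slidesUp-invariant zero    S inv = inv
  slidesUp-invariant (suc n) S inv = slidesUp-invariant n (slideRow α β γ n S) (slideRow-invariant n S inv)

  invariant-at-start : ∀ {T b ra ca cb} → IsFilling (row α) T (row α) (row β)
    → a > b → T ra ca ≡ just a → T j cb ≡ just b → ca < cb → Invariant (length β) T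
  invariant-at-start {T} {b} {ra} {ca} {cb} F a>b ea eb ca<cb =
    invariant (row α) (IsFilling-inner-cong β≡inner F) (located ra ca ea j<ra (inj₁ (smaller-at cb b eb a>b ca<cb)))
    where
    β≡inner : ∀ r → row β r ≡ innerAfter (length β) r
    β≡inner r with r <? length β
    ... | yes _     = refl
    ... | no  r≮len =
          let β≡0 = row-beyond-length β r (≮⇒≥ r≮len)
          in trans β≡0 (sym (n≤0⇒n≡0 (subst (row γ r ≤_) β≡0 (γ⊆β r))))
    j<ra : j < ra
    j<ra with j <? ra
    ... | yes j<ra = j<ra
    ... | no  j≮ra =
          let ra≤j = ≮⇒≥ j≮ra
          in contradiction (IsFilling.ordered F ra ca j cb a b ea eb ra≤j (<⇒≤ ca<cb) (+-mono-≤-< ra≤j ca<cb)) (<-asym a>b)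

mainTheorem18 : (α β γ : List ℕ) → IsPartition α → IsPartition β → IsPartition γ
    → β ⊆ α → γ ⊆ β → (∀ i → row β i ≤ suc (row γ i))
    → (T : Tab) → IsStandardSkew α β T
    → (a b ra ca j cb : ℕ) → a > b
    → T ra ca ≡ just a → T j cb ≡ just b → ca < cb
    → ∃[ r ] ∃[ c ] (slideInto α β γ T r c ≡ just a × j < r)
mainTheorem18 α β γ hα hβ hγ β⊆α γ⊆β strip T std a b ra ca j cb a>b ea eb ca<cb = aRow , aCol , a-at , j<aRow
  where
  open Shelter α β γ hα hβ hγ γ⊆β strip a j
  initial = invariant-at-start (standard-filling hα hβ β⊆α std) a>b ea eb ca<cb
  open LocatedBelowJ (Invariant.a-below (slidesUp-invariant (length β) T initial))
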